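{- Let $d\ge2$ and let $\boldsymbol\pi$ be a $d$-permutation avoiding the pattern $(21,12)$. If $p_1,p_2$ are points of $\boldsymbol\pi$ with $\pi_{d-1}(p_1)>\pi_{d-1}(p_2)$, then ${\bf dir}(p_1,p_2)\in F$.
   Context: A $d$-permutation of size $n$ is a tuple $\boldsymbol{\pi}=(\pi_1,\ldots,\pi_{d-1})$ of permutations of $[n]$; put $\pi_0=\mathrm{id}$. Its points are $(i,\pi_1(i),\ldots,\pi_{d-1}(i))$, $i\in[n]$, and $\pi_l(p)$ is the $l$-th coordinate of point $p$. For distinct points $p,q$, ${\bf dir}(p,q)=(\mathrm{sign}(\pi_0(q)-\pi_0(p)),\ldots,\mathrm{sign}(\pi_{d-1}(q)-\pi_{d-1}(p)))\in\{+1,-1\}^d$. $F=\{{\bf dir}^0,\ldots,{\bf dir}^{d-1}\}$ where ${\bf dir}^i=(\underbrace{+1,\ldots,+1}_{i},\underbrace{ -1,\ldots,-1}_{d-i})$. $\boldsymbol\pi$ contains the pattern $(21,12)$ (the $3$-permutation of size 2 with components $21$ and $12$, in the sense of containment via a direct projection $(\pi_{j}\pi_{i}^{ -1},\pi_{k}\pi_{i}^{ -1})$, $i<j<k$) iff there are points $p,q$ and indices $0\le i<j<k\le d-1$ with $\pi_i(p)<\pi_i(q)$, $\pi_j(p)>\pi_j(q)$, $\pi_k(p)<\pi_k(q)$; it avoids it otherwise. -}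

module Defs where

open import Data.Nat using (ℕ; zero; suc; _∸_)
open import Data.Fin using (Fin; zero; suc; toℕ; _<_)
open import Data.Fin.Permutation using (Permutation′; _⟨$⟩ʳ_)
open import Data.Product using (Σ; ∃; ∃-syntax; _×_; _,_)
open import Data.Sign using (Sign; +; -)
open import Relation.Nullary using (¬_; yes; no)
open import Relation.Nullary.Decidable using (does)
open import Data.Bool using (if_then_else_)
open import Relation.Binary.PropositionalEquality using (_≡_)

-- A d-permutation of size n: a tuple (π₁,…,π_{d-1}) of permutations of [n].
-- Points and coordinates are indexed by Fin n (i.e. [n] shifted to 0-based).
DPerm : ℕ → ℕ → Set
DPerm d n = Fin (d ∸ 1) → Permutation′ n

-- π_l(p), with π₀ = id.
coord : ∀ {d n} → DPerm d n → Fin d → Fin n → Fin n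
coord {suc d} π zero    p = p
coord {suc d} π (suc l) p = π l ⟨$⟩ʳ p

-- sign(b - a) for a ≠ b (if a = b we return -, which never matters since
-- dir is only used for distinct points, whose coordinates all differ).
sgn : ∀ {n} → Fin n → Fin n → Sign
sgn a b = if does (Data.Fin._<?_ a b) then + else -

dir : ∀ {d n} → DPerm d n → Fin n → Fin n → Fin d → Sign
dir {d} π p q l = sgn (coord {d} π l p) (coord {d} π l q)

dirF : ∀ {d} → Fin d → Fin d → Sign
dirF i l = if does (Data.Fin._<?_ l i) then + else -

InF : ∀ {d} → (Fin d → Sign) → Set
InF {d} v = ∃[ i ] (∀ l → v l ≡ dirF {d} i l)

Contains2112 : ∀ {d n} → DPerm d n → Set
Contains2112 {d} {n} π =
  ∃[ p ] ∃[ q ] ∃[ i ] ∃[ j ] ∃[ k ]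
    (i < j × j < k ×
     coord {d} π i p < coord {d} π i q ×
     coord {d} π j q < coord {d} π j p ×
     coord {d} π k p < coord {d} π k q)

Avoids2112 : ∀ {d n} → DPerm d n → Set
Avoids2112 {d} π = ¬ Contains2112 {d} π

last : ∀ m → Fin (suc m)
last m = Data.Fin.fromℕ m

-- Let v = dir(p₁,p₂); its last entry is −1 by hypothesis. If some j < k had
-- v_j = −1 and v_k = +1, then k < d−1 and the pair (p₂,p₁) with the indices
-- j < k < d−1 would be an occurrence of (21,12). So every +1 of v precedes
-- every −1, i.e. v = dir^i where i is the number of +1 entries, and i < d
-- because the last entry is −1.
module Submission where

open import Defs
open import Data.Bool using (if_then_else_)
open import Data.Fin using (Fin; _<_; zero; suc; fromℕ)
open import Data.Fin.Properties using (_<?_; <-asym; <-irrefl; <-cmp; ≤fromℕ; ≤∧≢⇒<)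
open import Data.Nat using (ℕ; suc; _≤_; s<s; z<s)
open import Data.Product using (_,_)
open import Data.Sign using (Sign; +; -)
open import Function using (_∘_; Injection)
open import Function.Definitions using (Injective)
open import Function.Properties.Inverse using (↔⇒↣)
open import Relation.Binary.Definitions using (tri<; tri≈; tri>)
open import Relation.Binary.PropositionalEquality using (_≡_; _≢_; refl)
open import Relation.Nullary using (¬_; Dec; yes; no; does; contradiction)

-- sgn a b is definitionally signOf (a <? b), so facts about sgn reduce to
-- matching on the decision.
signOf : ∀ {A : Set} → Dec A → Sign
signOf a? = if does a? then + else -

module _ {A : Set} where

  signOf≡+⇒ : (a? : Dec A) → signOf a? ≡ + → A
  signOf≡+⇒ (yes a) _  = a
  signOf≡+⇒ (no _)  ()

  signOf≡-⇒¬ : (a? : Dec A) → signOf a? ≡ - → ¬ A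
  signOf≡-⇒¬ (yes _)  ()
  signOf≡-⇒¬ (no ¬a) _ = ¬a

  ¬⇒signOf≡- : (a? : Dec A) → ¬ A → signOf a? ≡ -
  ¬⇒signOf≡- (yes a) ¬a = contradiction a ¬a
  ¬⇒signOf≡- (no _)  _  = refl

module _ {n : ℕ} {a b : Fin n} where

  sgn≡+⇒< : sgn a b ≡ + → a < b
  sgn≡+⇒< = signOf≡+⇒ (a <? b)

  >⇒sgn≡- : b < a → sgn a b ≡ -
  >⇒sgn≡- b<a = ¬⇒signOf≡- (a <? b) (<-asym b<a)

  sgn≡-∧≢⇒> : sgn a b ≡ - → a ≢ b → b < a
  sgn≡-∧≢⇒> s a≢b with <-cmp a b
  ... | tri< a<b _ _ = contradiction a<b (signOf≡-⇒¬ (a <? b) s)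
  ... | tri≈ _ a≡b _ = contradiction a≡b a≢b
  ... | tri> _ _ b<a = b<a

coord-injective : ∀ {d n} (π : DPerm d n) (l : Fin d) →
  Injective _≡_ _≡_ (coord {d} π l)
coord-injective {suc d} π zero    e = e
coord-injective {suc d} π (suc l) = Injection.injective (↔⇒↣ (π l))

≢+⇒≡- : {s : Sign} → s ≢ + → s ≡ -
≢+⇒≡- { - } _   = refl
≢+⇒≡- { + } s≢+ = contradiction refl s≢+

NoAscent : ∀ {d} → (Fin d → Sign) → Set
NoAscent {d} v = ∀ {j k : Fin d} → j < k → v j ≡ - → v k ≢ +

noAscent-tail : ∀ {d} {v : Fin (suc d) → Sign} → NoAscent v → NoAscent (v ∘ suc)
noAscent-tail noAsc j<k = noAsc (s<s j<k)

noAscent∧last≡-⇒InF : ∀ m (v : Fin (suc m) → Sign) →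
  v (fromℕ m) ≡ - → NoAscent v → InF v
noAscent∧last≡-⇒InF 0       v vLast _     = zero , λ { zero → vLast }
noAscent∧last≡-⇒InF (suc m) v vLast noAsc with v zero in v₀
... | - = zero , λ { zero → v₀ ; (suc l) → ≢+⇒≡- (noAsc z<s v₀) }
... | + with noAscent∧last≡-⇒InF m (v ∘ suc) vLast (noAscent-tail noAsc)
...   | i , v∘suc≡dirF = suc i , λ { zero → v₀ ; (suc l) → v∘suc≡dirF l }

dir-noAscent : ∀ m {n} (π : DPerm (suc m) n) → Avoids2112 {suc m} π → {p₁ p₂ : Fin n} →
  coord {suc m} π (last m) p₂ < coord {suc m} π (last m) p₁ →
  NoAscent (dir {suc m} π p₁ p₂)
dir-noAscent m π avoids {p₁} {p₂} lastDesc {j} {k} j<k vⱼ vₖ =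
  avoids (p₂ , p₁ , j , k , last m , j<k , k<last , descⱼ , sgn≡+⇒< vₖ , lastDesc)
  where
  p₁≢p₂ : p₁ ≢ p₂
  p₁≢p₂ refl = <-irrefl refl lastDesc

  descⱼ : coord {suc m} π j p₂ < coord {suc m} π j p₁
  descⱼ = sgn≡-∧≢⇒> vⱼ (p₁≢p₂ ∘ coord-injective {suc m} π j)

  k<last : k < last m
  k<last = ≤∧≢⇒< (≤fromℕ k) λ { refl → <-asym (sgn≡+⇒< vₖ) lastDesc }

lemma3 : (m n : ℕ) → 1 ≤ m → (π : DPerm (suc m) n) → Avoids2112 {suc m} π →
    (p₁ p₂ : Fin n) → coord {suc m} π (last m) p₂ < coord {suc m} π (last m) p₁ →
    InF (dir {suc m} π p₁ p₂)
lemma3 m _ _ π avoids p₁ p₂ lastDesc =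
  noAscent∧last≡-⇒InF m (dir {suc m} π p₁ p₂)
    (>⇒sgn≡- lastDesc) (dir-noAscent m π avoids lastDesc)
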